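{- Let $p>2$ be a prime, $l\in\mathbb{N}$, $0\le k<l$, and let $x\in\frac{1}{2p^k}\dot{\mathbb{Z}}=\{a/(2p^k): a\in\mathbb{Z},\ \gcd(a,2p)=1\}$. Then there exists a unique integer $t$ such that $t/p^l$ and $(t+1)/p^l$ lie in $\mathcal{X}_{p^l}$ and $x=\frac{t}{p^l}\oplus\frac{t+1}{p^l}$.
   Context: $\mathcal{X}_{p^l}=\{x/y: x,y\in\mathbb{Z},\ y>0,\ \gcd(x,y)=1,\ p^l\mid y\}\cup\{\infty\}$. For reduced fractions $r_1/s_1,r_2/s_2$ the Farey sum $\frac{r_1}{s_1}\oplus\frac{r_2}{s_2}$ is the rational number $\frac{r_1+r_2}{s_1+s_2}$; equality with $x$ is equality of rational numbers. -}

module Defs where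

open import Data.Nat using (ℕ; zero; suc; _+_; _*_; _^_)
open import Data.Nat.Divisibility using (_∣_)
open import Data.Integer using (ℤ) renaming (_+_ to _+ℤ_)
open import Data.Rational using (ℚ; _/_; 0ℚ)
open ℚ using (numerator; denominatorℕ)

-- Division of an integer by a natural number, giving a reduced rational.
-- Only ever used with nonzero denominators; the zero case is a dummy.
_/ₙ_ : ℤ → ℕ → ℚ
n /ₙ zero    = 0ℚ
n /ₙ suc d   = n / suc d

-- Membership in 𝒳_{m} (for finite rationals): writing q = x/y in lowest
-- terms with y > 0, we require m ∣ y.  (The point ∞ is not a rational.)
InX : ℕ → ℚ → Set
InX m q = m ∣ denominatorℕ q

_⊕_ : ℚ → ℚ → ℚ
q ⊕ r = (numerator q +ℤ numerator r) /ₙ (denominatorℕ q + denominatorℕ r)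

-- Write l = k + m with m ≥ 1, so that x = N/(2pˡ) with N = a·pᵐ. As a is prime to 2 and p is odd,
-- N is odd, N = t + (t+1). Since p ∣ 2t+1, p divides neither t nor t+1, so t/pˡ and (t+1)/pˡ are
-- already reduced with denominator pˡ and their Farey sum is N/(2pˡ) = x. Conversely, membership in
-- 𝒳_{pˡ} forces t′/pˡ and (t′+1)/pˡ to be reduced, so their Farey sum is (2t′+1)/(2pˡ), and comparing
-- with x = (2t+1)/(2pˡ) over the same denominator gives t′ = t.
module Submission where

open import Defs
open import Data.Nat as ℕ using (ℕ; suc; _<_; _*_; _^_; NonZero)
import Data.Nat.Properties as ℕ
open import Data.Nat.Divisibility as ℕ using (_∣_; divides)
open import Data.Nat.GCD as ℕ using ()
open import Data.Nat.Coprimality as Coprime using (Coprime; coprime⇒gcd≡1; gcd≡1⇒coprime)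
open import Data.Nat.Primality using (Prime; prime⇒irreducible; prime⇒nonZero; ¬prime[1])
open import Data.Integer as ℤ using (ℤ; ∣_∣; +_; _-_) renaming (_+_ to _+ℤ_)
import Data.Integer.Properties as ℤ
import Data.Integer.DivMod as ℤ
open import Data.Integer.Divisibility.Signed as Signed using (∣ᵤ⇒∣; ∣⇒∣ᵤ)
open import Data.Integer.Tactic.RingSolver using (solve-∀)
open import Data.Rational using (ℚ; ↥_; ↧ₙ_)
open import Data.Rational.Properties using (↥-/; ↧-/; fromℚᵘ-cong; fromℚᵘ-injective)
open import Data.Rational.Unnormalised using (mkℚᵘ; *≡*)
open import Data.Product using (∃; _×_; ∃!; _,_; proj₁; proj₂)
open import Data.Sum using (inj₁; inj₂)
open import Relation.Nullary using (¬_; contradiction)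
open import Relation.Binary.PropositionalEquality

↧ₙ-/ₙ*gcd : ∀ i n .{{_ : NonZero n}} → ↧ₙ (i /ₙ n) * ℕ.gcd ∣ i ∣ n ≡ n
↧ₙ-/ₙ*gcd i (suc n) = ℤ.+-injective (trans (ℤ.pos-* (↧ₙ (i /ₙ suc n)) (ℕ.gcd ∣ i ∣ (suc n))) (↧-/ i (suc n)))

↥-/ₙ*gcd : ∀ i n .{{_ : NonZero n}} → ↥ (i /ₙ n) ℤ.* + ℕ.gcd ∣ i ∣ n ≡ i
↥-/ₙ*gcd i (suc n) = ↥-/ i (suc n)

↥-/ₙ-coprime : ∀ i n .{{_ : NonZero n}} → Coprime ∣ i ∣ n → ↥ (i /ₙ n) ≡ i
↥-/ₙ-coprime i n c = begin
  ↥ (i /ₙ n)                       ≡⟨ ℤ.*-identityʳ _ ⟨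
  ↥ (i /ₙ n) ℤ.* + 1               ≡⟨ cong (λ g → ↥ (i /ₙ n) ℤ.* + g) (coprime⇒gcd≡1 c) ⟨
  ↥ (i /ₙ n) ℤ.* + ℕ.gcd ∣ i ∣ n   ≡⟨ ↥-/ₙ*gcd i n ⟩
  i                                ∎
  where open ≡-Reasoning

↧ₙ-/ₙ-coprime : ∀ i n .{{_ : NonZero n}} → Coprime ∣ i ∣ n → ↧ₙ (i /ₙ n) ≡ n
↧ₙ-/ₙ-coprime i n c = begin
  ↧ₙ (i /ₙ n)                      ≡⟨ ℕ.*-identityʳ _ ⟨
  ↧ₙ (i /ₙ n) * 1                  ≡⟨ cong (↧ₙ (i /ₙ n) *_) (coprime⇒gcd≡1 c) ⟨
  ↧ₙ (i /ₙ n) * ℕ.gcd ∣ i ∣ n      ≡⟨ ↧ₙ-/ₙ*gcd i n ⟩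
  n                                ∎
  where open ≡-Reasoning

InX-/ₙ⇒coprime : ∀ i n .{{_ : NonZero n}} → InX n (i /ₙ n) → Coprime ∣ i ∣ n
InX-/ₙ⇒coprime i n n∣↧ = gcd≡1⇒coprime (ℕ.*-cancelˡ-≡ _ 1 n n*g≡n*1)
  where
  ↧∣n : ↧ₙ (i /ₙ n) ∣ n
  ↧∣n = divides (ℕ.gcd ∣ i ∣ n) (trans (sym (↧ₙ-/ₙ*gcd i n)) (ℕ.*-comm (↧ₙ (i /ₙ n)) (ℕ.gcd ∣ i ∣ n)))
  n*g≡n*1 : n * ℕ.gcd ∣ i ∣ n ≡ n * 1
  n*g≡n*1 = trans (cong (_* ℕ.gcd ∣ i ∣ n) (ℕ.∣-antisym n∣↧ ↧∣n))
                  (trans (↧ₙ-/ₙ*gcd i n) (sym (ℕ.*-identityʳ n)))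

coprime⇒InX-/ₙ : ∀ i n .{{_ : NonZero n}} → Coprime ∣ i ∣ n → InX n (i /ₙ n)
coprime⇒InX-/ₙ i n c = ℕ.∣-reflexive (sym (↧ₙ-/ₙ-coprime i n c))

⊕-/ₙ : ∀ i j n m .{{_ : NonZero n}} .{{_ : NonZero m}} → Coprime ∣ i ∣ n → Coprime ∣ j ∣ m →
       (i /ₙ n) ⊕ (j /ₙ m) ≡ (i +ℤ j) /ₙ (n ℕ.+ m)
⊕-/ₙ i j n m cᵢ cⱼ = cong₂ _/ₙ_ (cong₂ _+ℤ_ (↥-/ₙ-coprime i n cᵢ) (↥-/ₙ-coprime j m cⱼ))
                                (cong₂ ℕ._+_ (↧ₙ-/ₙ-coprime i n cᵢ) (↧ₙ-/ₙ-coprime j m cⱼ))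

/ₙ-cong-* : ∀ i j n m .{{_ : NonZero n}} .{{_ : NonZero m}} →
            i ℤ.* + m ≡ j ℤ.* + n → i /ₙ n ≡ j /ₙ m
/ₙ-cong-* i j (suc n) (suc m) eq = fromℚᵘ-cong {mkℚᵘ i n} {mkℚᵘ j m} (*≡* eq)

/ₙ-injectiveˡ : ∀ i j n .{{_ : NonZero n}} → i /ₙ n ≡ j /ₙ n → i ≡ j
/ₙ-injectiveˡ i j (suc n) eq with fromℚᵘ-injective {mkℚᵘ i n} {mkℚᵘ j n} eq
... | *≡* i*n≡j*n = ℤ.*-cancelʳ-≡ i j (+ suc n) i*n≡j*n

*/ₙ*-cancelʳ : ∀ i n m .{{_ : NonZero n}} .{{_ : NonZero m}} → (i ℤ.* + m) /ₙ (n * m) ≡ i /ₙ n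
*/ₙ*-cancelʳ i n@(suc _) m@(suc _) = /ₙ-cong-* (i ℤ.* + m) i (n * m) n (begin
  i ℤ.* + m ℤ.* + n        ≡⟨ reorder i (+ m) (+ n) ⟩
  i ℤ.* (+ n ℤ.* + m)      ≡⟨ cong (i ℤ.*_) (ℤ.pos-* n m) ⟨
  i ℤ.* + (n * m)          ∎)
  where
  open ≡-Reasoning
  reorder : ∀ a b c → a ℤ.* b ℤ.* c ≡ a ℤ.* (c ℤ.* b)
  reorder = solve-∀

coprime-* : ∀ {m a b} → Coprime m a → Coprime m b → Coprime m (a * b)
coprime-* m⊥a m⊥b (d∣m , d∣ab) =
  m⊥b (d∣m , Coprime.coprime-divisor (λ (e∣d , e∣a) → m⊥a (ℕ.∣-trans e∣d d∣m , e∣a)) d∣ab)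

coprime-^ : ∀ {m a} → Coprime m a → ∀ j → Coprime m (a ^ j)
coprime-^ _    0       (_ , d∣1) = ℕ.∣1⇒≡1 d∣1
coprime-^ m⊥a (suc j) = coprime-* m⊥a (coprime-^ m⊥a j)

∤⇒coprime : ∀ {p n} → Prime p → ¬ p ∣ n → Coprime n p
∤⇒coprime p-prime p∤n (d∣n , d∣p) with prime⇒irreducible p-prime d∣p
... | inj₁ d≡1  = d≡1
... | inj₂ refl = contradiction d∣n p∤n

coprime-2⇒consecutive-sum : ∀ N → Coprime ∣ N ∣ 2 → ∃ λ t → N ≡ t +ℤ (t +ℤ + 1)
coprime-2⇒consecutive-sum N N⊥2 =
  from-remainder (N ℤ.% + 2) (ℤ.n%d<d N (+ 2)) (ℤ.a≡a%n+[a/n]*n N (+ 2))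
  where
  q : ℤ
  q = N ℤ./ + 2
  from-remainder : ∀ r → r < 2 → N ≡ + r +ℤ q ℤ.* + 2 → ∃ λ t → N ≡ t +ℤ (t +ℤ + 1)
  from-remainder 0 _ N≡2q = contradiction (N⊥2 (2∣N , ℕ.∣-refl)) λ ()
    where
    2∣N : 2 ∣ ∣ N ∣
    2∣N = divides ∣ q ∣ (trans (cong ∣_∣ (trans N≡2q (ℤ.+-identityˡ (q ℤ.* + 2)))) (ℤ.abs-* q (+ 2)))
  from-remainder 1 _ N≡1+2q = q , trans N≡1+2q (odd q)
    where
    odd : ∀ t → + 1 +ℤ t ℤ.* + 2 ≡ t +ℤ (t +ℤ + 1)
    odd = solve-∀
  from-remainder (suc (suc _)) (ℕ.s≤s (ℕ.s≤s ())) _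

consecutive-sum-injective : ∀ t u → t +ℤ (t +ℤ + 1) ≡ u +ℤ (u +ℤ + 1) → t ≡ u
consecutive-sum-injective t u eq =
  ℤ.*-cancelʳ-≡ t u (+ 2) (trans (double t) (trans (cong (_- + 1) eq) (sym (double u))))
  where
  double : ∀ s → s ℤ.* + 2 ≡ s +ℤ (s +ℤ + 1) - + 1
  double = solve-∀

module _ {d t : ℤ} (d∣sum : d Signed.∣ t +ℤ (t +ℤ + 1)) where

  ∣consecutive-sum∧∣ˡ⇒∣1 : d Signed.∣ t → d Signed.∣ + 1
  ∣consecutive-sum∧∣ˡ⇒∣1 d∣t = subst (d Signed.∣_) (difference t)
    (Signed.∣m∣n⇒∣m-n d∣sum (Signed.∣m∣n⇒∣m+n d∣t d∣t))
    where
    difference : ∀ s → s +ℤ (s +ℤ + 1) - (s +ℤ s) ≡ + 1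
    difference = solve-∀

  ∣consecutive-sum∧∣ʳ⇒∣1 : d Signed.∣ t +ℤ + 1 → d Signed.∣ + 1
  ∣consecutive-sum∧∣ʳ⇒∣1 d∣t+1 = subst (d Signed.∣_) (difference t)
    (Signed.∣m∣n⇒∣m-n (Signed.∣m∣n⇒∣m+n d∣t+1 d∣t+1) d∣sum)
    where
    difference : ∀ s → (s +ℤ + 1) +ℤ (s +ℤ + 1) - (s +ℤ (s +ℤ + 1)) ≡ + 1
    difference = solve-∀

consecutive-summands-coprime : ∀ {p} t → Prime p → p ∣ ∣ t +ℤ (t +ℤ + 1) ∣ → ∀ l →
  (Coprime ∣ t ∣ (p ^ l)) × (Coprime ∣ t +ℤ + 1 ∣ (p ^ l))
consecutive-summands-coprime {p} t p-prime p∣sum l =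
    coprime-^ (∤⇒coprime p-prime (λ p∣t → p∤1 (∣consecutive-sum∧∣ˡ⇒∣1 {t = t} p∣sum′ (∣ᵤ⇒∣ p∣t)))) l
  , coprime-^ (∤⇒coprime p-prime (λ p∣t+1 → p∤1 (∣consecutive-sum∧∣ʳ⇒∣1 {t = t} p∣sum′ (∣ᵤ⇒∣ p∣t+1)))) l
  where
  p∣sum′ : + p Signed.∣ t +ℤ (t +ℤ + 1)
  p∣sum′ = ∣ᵤ⇒∣ p∣sum
  p∤1 : ¬ + p Signed.∣ + 1
  p∤1 p∣1 = ¬prime[1] (subst Prime (ℕ.∣1⇒≡1 (∣⇒∣ᵤ p∣1)) p-prime)

coprime-2p⇒split-a*p^[1+o] : ∀ {p a} → Prime p → 2 < p → Coprime ∣ a ∣ (2 * p) → ∀ o l →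
  ∃ λ t → a ℤ.* + (p ^ suc o) ≡ t +ℤ (t +ℤ + 1)
        × (Coprime ∣ t ∣ (p ^ l)) × (Coprime ∣ t +ℤ + 1 ∣ (p ^ l))
coprime-2p⇒split-a*p^[1+o] {p} {a} p-prime 2<p a⊥2p o l =
  t , N≡t+[t+1] , consecutive-summands-coprime t p-prime (subst (λ n → p ∣ ∣ n ∣) N≡t+[t+1] p∣N) l
  where
  N : ℤ
  N = a ℤ.* + (p ^ suc o)
  ∣N∣≡ : ∣ a ∣ * p ^ suc o ≡ ∣ N ∣
  ∣N∣≡ = sym (ℤ.abs-* a (+ (p ^ suc o)))
  2⊥a : Coprime 2 ∣ a ∣
  2⊥a (d∣2 , d∣a) = a⊥2p (d∣a , ℕ.∣-trans d∣2 (ℕ.m∣m*n p))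
  N⊥2 : Coprime ∣ N ∣ 2
  N⊥2 = subst (λ n → Coprime n 2) ∣N∣≡
          (Coprime.sym (coprime-* 2⊥a (coprime-^ (Coprime.sym (Coprime.prime⇒coprime p-prime 2<p)) (suc o))))
  p∣N : p ∣ ∣ N ∣
  p∣N = subst (p ∣_) ∣N∣≡ (ℕ.∣n⇒∣m*n ∣ a ∣ (ℕ.m∣m*n (p ^ o)))
  t : ℤ
  t = proj₁ (coprime-2⇒consecutive-sum N N⊥2)
  N≡t+[t+1] : N ≡ t +ℤ (t +ℤ + 1)
  N≡t+[t+1] = proj₂ (coprime-2⇒consecutive-sum N N⊥2)

∃!-consecutive-⊕ : ∀ n .{{_ : NonZero n}} x N → x ≡ N /ₙ (2 * n) →
  (∃ λ t → N ≡ t +ℤ (t +ℤ + 1) × (Coprime ∣ t ∣ n) × (Coprime ∣ t +ℤ + 1 ∣ n)) →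
  ∃! _≡_ (λ s → InX n (s /ₙ n) × InX n ((s +ℤ + 1) /ₙ n) × x ≡ (s /ₙ n) ⊕ ((s +ℤ + 1) /ₙ n))
∃!-consecutive-⊕ n@(suc _) x N x≡N/2n (t , N≡t+[t+1] , t⊥n , t+1⊥n) =
    t
  , (coprime⇒InX-/ₙ t n t⊥n , coprime⇒InX-/ₙ (t +ℤ + 1) n t+1⊥n , trans x≡2t+1/2n (sym (⊕≡ t t⊥n t+1⊥n)))
  , λ {s} (s∈X , s+1∈X , x≡⊕) → consecutive-sum-injective t s (/ₙ-injectiveˡ _ _ (2 * n) (begin
      (t +ℤ (t +ℤ + 1)) /ₙ (2 * n)     ≡⟨ x≡2t+1/2n ⟨
      x                                 ≡⟨ x≡⊕ ⟩
      (s /ₙ n) ⊕ ((s +ℤ + 1) /ₙ n)     ≡⟨ ⊕≡ s (InX-/ₙ⇒coprime s n s∈X) (InX-/ₙ⇒coprime (s +ℤ + 1) n s+1∈X) ⟩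
      (s +ℤ (s +ℤ + 1)) /ₙ (2 * n)     ∎))
  where
  open ≡-Reasoning
  ⊕≡ : ∀ s → Coprime ∣ s ∣ n → Coprime ∣ s +ℤ + 1 ∣ n →
       (s /ₙ n) ⊕ ((s +ℤ + 1) /ₙ n) ≡ (s +ℤ (s +ℤ + 1)) /ₙ (2 * n)
  ⊕≡ s s⊥n s+1⊥n = trans (⊕-/ₙ s (s +ℤ + 1) n n s⊥n s+1⊥n)
                         (cong ((s +ℤ (s +ℤ + 1)) /ₙ_) (cong (n ℕ.+_) (sym (ℕ.+-identityʳ n))))
  x≡2t+1/2n : x ≡ (t +ℤ (t +ℤ + 1)) /ₙ (2 * n)
  x≡2t+1/2n = trans x≡N/2n (cong (_/ₙ (2 * n)) N≡t+[t+1])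

mainTheorem13 : (p : ℕ) → Prime p → 2 < p → (l k : ℕ) → k < l →
    (x : ℚ) → (∃ λ (a : ℤ) → Coprime ∣ a ∣ (2 * p) × x ≡ a /ₙ (2 * p ^ k)) →
    ∃! _≡_ (λ (t : ℤ) → InX (p ^ l) (t /ₙ (p ^ l))
                       × InX (p ^ l) ((t +ℤ + 1) /ₙ (p ^ l))
                       × x ≡ (t /ₙ (p ^ l)) ⊕ ((t +ℤ + 1) /ₙ (p ^ l)))
mainTheorem13 p p-prime 2<p l k k<l x (a , a⊥2p , x≡a/2pᵏ) =
  ∃!-consecutive-⊕ (p ^ l) x (a ℤ.* + (p ^ m)) x≡a·pᵐ/2pˡ
    (coprime-2p⇒split-a*p^[1+o] {a = a} p-prime 2<p a⊥2p o l)
  where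
  o : ℕ
  o = proj₁ (ℕ.m≤n⇒∃[o]m+o≡n k<l)
  m : ℕ
  m = suc o
  instance
    p≢0 : NonZero p
    p≢0 = prime⇒nonZero p-prime
    2pᵏ≢0 : NonZero (2 * p ^ k)
    2pᵏ≢0 = ℕ.m*n≢0 2 (p ^ k) {{_}} {{ℕ.m^n≢0 p k}}
    pᵐ≢0 : NonZero (p ^ m)
    pᵐ≢0 = ℕ.m^n≢0 p m
    pˡ≢0 : NonZero (p ^ l)
    pˡ≢0 = ℕ.m^n≢0 p l
  pᵏ*pᵐ≡pˡ : p ^ k * p ^ m ≡ p ^ l
  pᵏ*pᵐ≡pˡ = trans (sym (ℕ.^-distribˡ-+-* p k m))
                   (cong (p ^_) (trans (ℕ.+-suc k o) (proj₂ (ℕ.m≤n⇒∃[o]m+o≡n k<l))))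
  x≡a·pᵐ/2pˡ : x ≡ (a ℤ.* + (p ^ m)) /ₙ (2 * p ^ l)
  x≡a·pᵐ/2pˡ = begin
    x                                          ≡⟨ x≡a/2pᵏ ⟩
    a /ₙ (2 * p ^ k)                           ≡⟨ */ₙ*-cancelʳ a (2 * p ^ k) (p ^ m) ⟨
    (a ℤ.* + (p ^ m)) /ₙ (2 * p ^ k * p ^ m)   ≡⟨ cong ((a ℤ.* + (p ^ m)) /ₙ_) (ℕ.*-assoc 2 (p ^ k) (p ^ m)) ⟩
    (a ℤ.* + (p ^ m)) /ₙ (2 * (p ^ k * p ^ m)) ≡⟨ cong (λ d → (a ℤ.* + (p ^ m)) /ₙ (2 * d)) pᵏ*pᵐ≡pˡ ⟩
    (a ℤ.* + (p ^ m)) /ₙ (2 * p ^ l)           ∎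
    where open ≡-Reasoning
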